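{- Let $F(x,y)=a_0x^4+a_1x^3y+a_2x^2y^2+a_3xy^3+a_4y^4$ be a binary quartic form with integer coefficients, irreducible over $\mathbb{Q}$, with $J_F=0$. Then there exists a form $G$ equivalent to $F$ such that the coefficients $A_3,A_4$ of the Hessian of $G$ satisfy $A_3A_4\neq 0$.
   Context: $J_F=2a_2^3-9a_1a_2a_3+27a_1^2a_4-72a_0a_2a_4+27a_0a_3^2$. Two forms $F_1,F_2$ are equivalent if there are integers $b,c,d,e$ with $be-cd=\pm1$ and $F_1(bx+cy,dx+ey)=F_2(x,y)$ identically. For a quartic form $G(x,y)=g_0x^4+g_1x^3y+g_2x^2y^2+g_3xy^3+g_4y^4$ its Hessian is $G_{xx}G_{yy}-G_{xy}^2=A_0x^4+A_1x^3y+A_2x^2y^2+A_3xy^3+A_4y^4$, where in particular $A_3=12(6g_1g_4-g_2g_3)$ and $A_4=3(8g_2g_4-3g_3^2)$. -}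

module Defs where

open import Data.Nat as ℕ using (ℕ; zero; suc)
open import Data.Integer as ℤ using (ℤ; +_; -[1+_])
open import Data.Rational as ℚ using (ℚ; 0ℚ; 1ℚ)
open import Data.List using (List; []; _∷_; map; length)
open import Data.Product using (Σ; ∃; _×_; _,_)
open import Data.Sum using (_⊎_)
open import Relation.Nullary using (¬_)
open import Relation.Binary.PropositionalEquality using (_≡_)

-- Binary forms (homogeneous polynomials in x, y) over a commutative
-- semiring-like carrier, represented by their coefficient lists:
-- the list  c₀ ∷ c₁ ∷ … ∷ cₙ ∷ []  stands for  Σ cᵢ x^(n-i) y^i.
module FormOps {A : Set} (0# 1# : A) (_⊕_ _⊛_ : A → A → A) where

  _+F_ : List A → List A → List A
  [] +F q = q
  (a ∷ p) +F [] = a ∷ p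
  (a ∷ p) +F (b ∷ q) = (a ⊕ b) ∷ (p +F q)

  -- product of forms:  (a x^m + y·p)·q = a x^m q + y (p q)
  _*F_ : List A → List A → List A
  [] *F q = []
  (a ∷ p) *F q = map (a ⊛_) q +F (0# ∷ (p *F q))

  _^F_ : List A → ℕ → List A
  p ^F zero = 1# ∷ []
  p ^F suc k = p *F (p ^F k)

record Quartic : Set where
  constructor quartic
  field
    a₀ a₁ a₂ a₃ a₄ : ℤ
open Quartic public

coeffs : Quartic → List ℤ
coeffs F = a₀ F ∷ a₁ F ∷ a₂ F ∷ a₃ F ∷ a₄ F ∷ []

module ZF = FormOps (+ 0) (+ 1) ℤ._+_ ℤ._*_
module QF = FormOps 0ℚ 1ℚ ℚ._+_ ℚ._*_

-- coefficient list of F(bx+cy, dx+ey)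
substCoeffs : Quartic → ℤ → ℤ → ℤ → ℤ → List ℤ
substCoeffs F b c d e =
  term (a₀ F) 4 0 +F (term (a₁ F) 3 1 +F (term (a₂ F) 2 2 +F
    (term (a₃ F) 1 3 +F term (a₄ F) 0 4)))
  where
  open ZF
  L₁ L₂ : List ℤ
  L₁ = b ∷ c ∷ []
  L₂ = d ∷ e ∷ []
  term : ℤ → ℕ → ℕ → List ℤ
  term a i j = (a ∷ []) *F ((L₁ ^F i) *F (L₂ ^F j))

Equivalent : Quartic → Quartic → Set
Equivalent F₁ F₂ = Σ ℤ λ b → Σ ℤ λ c → Σ ℤ λ d → Σ ℤ λ e →
  ((b ℤ.* e ℤ.- c ℤ.* d ≡ + 1) ⊎ (b ℤ.* e ℤ.- c ℤ.* d ≡ ℤ.- (+ 1)))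
  × substCoeffs F₁ b c d e ≡ coeffs F₂

J : Quartic → ℤ
J (quartic a0 a1 a2 a3 a4) =
  + 2 ℤ.* a2 ℤ.* a2 ℤ.* a2 ℤ.- + 9 ℤ.* a1 ℤ.* a2 ℤ.* a3
  ℤ.+ + 27 ℤ.* a1 ℤ.* a1 ℤ.* a4 ℤ.- + 72 ℤ.* a0 ℤ.* a2 ℤ.* a4
  ℤ.+ + 27 ℤ.* a0 ℤ.* a3 ℤ.* a3

-- Coefficients A₃, A₄ of the Hessian G_xx G_yy - G_xy²
hessA₃ : Quartic → ℤ
hessA₃ (quartic g0 g1 g2 g3 g4) = + 12 ℤ.* (+ 6 ℤ.* g1 ℤ.* g4 ℤ.- g2 ℤ.* g3)

hessA₄ : Quartic → ℤ
hessA₄ (quartic g0 g1 g2 g3 g4) = + 3 ℤ.* (+ 8 ℤ.* g2 ℤ.* g4 ℤ.- + 3 ℤ.* g3 ℤ.* g3)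

toℚ : ℤ → ℚ
toℚ z = z ℚ./ 1

-- Irreducible over ℚ: F is not a product of two binary forms with
-- rational coefficients, each of degree ≥ 1 (coefficient list length ≥ 2).
IrreducibleQ : Quartic → Set
IrreducibleQ F = ¬ (Σ (List ℚ) λ p → Σ (List ℚ) λ q →
  (2 ℕ.≤ length p) × (2 ℕ.≤ length q) × (p QF.*F q ≡ map toℚ (coeffs F)))

{-# OPTIONS --safe #-}
-- The Hessian H of F is covariant: for a unimodular substitution M, the Hessian of F ∘ M is
-- H ∘ M. Hence the y⁴-coefficient of the Hessian of G = F(x + ky, y) is A₄(G) = H(k, 1). If H(k, 1)
-- vanished for the five values k = 0, ±1, ±2, the quartic H would be identically zero; but then
-- either a₄ = 0 and x divides F, or F = a₄ (s x + y)⁴ with s = a₃ / 4a₄, contradicting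
-- irreducibility. So A₄(G) ≠ 0 for one of these k. If also A₃(G) ≠ 0 we are done; otherwise
-- G(x, x + y) has Hessian coefficients A₃ = 4 A₄(G) and A₄ = A₄(G), both nonzero.
module Submission where

open import Defs
open import Data.Empty using (⊥-elim)
open import Data.Integer using (ℤ; +_; 0ℤ)
import Data.Integer as ℤ
import Data.Integer.Properties as ℤ
import Data.Integer.Tactic.RingSolver as ℤ-Solver
open import Data.List using (List; []; _∷_; length; map; foldl)
open import Data.List.Relation.Unary.All as All using (All; all?)
open import Data.List.Relation.Unary.All.Properties using (¬All⇒Any¬)
open import Data.List.Relation.Unary.Any using (satisfied)
open import Data.Nat using (ℕ; zero; suc; s≤s; z≤n; _≤_)
open import Data.Product using (Σ; _×_; _,_; uncurry)
open import Data.Sum using (_⊎_; inj₁; [_,_]′)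
open import Relation.Binary.PropositionalEquality
  using (_≡_; _≢_; refl; sym; trans; cong; cong₂; subst; module ≡-Reasoning)
open import Relation.Nullary using (Dec; yes; no)
open import Relation.Nullary.Decidable using (dec⇒maybe)

-- Rational arithmetic is kept in this scope, so that _+_ and _*_ denote the operations of ℤ below.
module _ where
  open import Data.Rational using (ℚ; 0ℚ; 1ℚ; _+_; _*_; 1/_; toℚᵘ; NonZero; ≢-nonZero)
  import Data.Rational.Properties as ℚ
  open import Data.Rational.Unnormalised using (mkℚᵘ; *≡*)
  import Data.Rational.Unnormalised as ℚᵘ
  import Data.Rational.Unnormalised.Properties as ℚᵘ
  open import Tactic.RingSolver.Core.AlmostCommutativeRing using (AlmostCommutativeRing; fromCommutativeRing)
  open import Tactic.RingSolver using (solve)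

  ℚ-ring : AlmostCommutativeRing _ _
  ℚ-ring = fromCommutativeRing ℚ.+-*-commutativeRing (λ x → dec⇒maybe (0ℚ ℚ.≟ x))

  ReducibleQ : Quartic → Set
  ReducibleQ F = Σ (List ℚ) λ p → Σ (List ℚ) λ q →
    (2 ≤ length p) × (2 ≤ length q) × (p QF.*F q ≡ map toℚ (coeffs F))

  -- toℚ z is fromℚᵘ (mkℚᵘ z 0) by definition, and toℚᵘ inverts fromℚᵘ up to ≃.
  toℚ-* : ∀ x y → toℚ (x ℤ.* y) ≡ toℚ x * toℚ y
  toℚ-* x y = ℚ.toℚᵘ-injective (begin-equality
    toℚᵘ (toℚ (x ℤ.* y))             ≃⟨ ℚ.toℚᵘ-fromℚᵘ (mkℚᵘ (x ℤ.* y) 0) ⟩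
    mkℚᵘ x 0 ℚᵘ.* mkℚᵘ y 0           ≃⟨ ℚᵘ.*-cong (ℚ.toℚᵘ-fromℚᵘ (mkℚᵘ x 0)) (ℚ.toℚᵘ-fromℚᵘ (mkℚᵘ y 0)) ⟨
    toℚᵘ (toℚ x) ℚᵘ.* toℚᵘ (toℚ y)   ≃⟨ ℚ.toℚᵘ-homo-* (toℚ x) (toℚ y) ⟨
    toℚᵘ (toℚ x * toℚ y)             ∎)
    where open ℚᵘ.≤-Reasoning

  toℚ-foldl-* : ∀ c xs → toℚ (foldl ℤ._*_ c xs) ≡ foldl _*_ (toℚ c) (map toℚ xs)
  toℚ-foldl-* c []       = refl
  toℚ-foldl-* c (x ∷ xs) =
    trans (toℚ-foldl-* (c ℤ.* x) xs) (cong (λ q → foldl _*_ q (map toℚ xs)) (toℚ-* c x))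

  toℚ-injective : ∀ {x y} → toℚ x ≡ toℚ y → x ≡ y
  toℚ-injective {x} {y} eq with ℚᵘ.≃-trans (ℚᵘ.≃-sym (ℚ.toℚᵘ-fromℚᵘ (mkℚᵘ x 0)))
                                  (ℚᵘ.≃-trans (ℚ.toℚᵘ-cong eq) (ℚ.toℚᵘ-fromℚᵘ (mkℚᵘ y 0)))
  ... | *≡* x*1≡y*1 = trans (sym (ℤ.*-identityʳ x)) (trans x*1≡y*1 (ℤ.*-identityʳ y))

  toℚ-transport : ∀ {x y p q} → toℚ x ≡ p → toℚ y ≡ q → x ≡ y → p ≡ q
  toℚ-transport refl refl refl = refl

  ≡-∷⁵ : ∀ {x₀ x₁ x₂ x₃ x₄ y₀ y₁ y₂ y₃ y₄ : ℚ} →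
    x₀ ≡ y₀ → x₁ ≡ y₁ → x₂ ≡ y₂ → x₃ ≡ y₃ → x₄ ≡ y₄ →
    x₀ ∷ x₁ ∷ x₂ ∷ x₃ ∷ x₄ ∷ [] ≡ y₀ ∷ y₁ ∷ y₂ ∷ y₃ ∷ y₄ ∷ []
  ≡-∷⁵ refl refl refl refl refl = refl

  x*cubic : ∀ t₀ t₁ t₂ t₃ →
    (1ℚ ∷ 0ℚ ∷ []) QF.*F (t₀ ∷ t₁ ∷ t₂ ∷ t₃ ∷ []) ≡ t₀ ∷ t₁ ∷ t₂ ∷ t₃ ∷ 0ℚ ∷ []
  x*cubic t₀ t₁ t₂ t₃ = ≡-∷⁵
    (solve (t₀ ∷ []) ℚ-ring) (solve (t₀ ∷ t₁ ∷ []) ℚ-ring)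
    (solve (t₁ ∷ t₂ ∷ []) ℚ-ring) (solve (t₂ ∷ t₃ ∷ []) ℚ-ring)
    (solve (t₃ ∷ []) ℚ-ring)

  module _ where
    open import Agda.Builtin.FromNat using (Number; fromNat)
    open import Data.Rational.Literals using (number)
    -- tt discharges the instance constraint of a numeral.
    open import Data.Unit using (tt)

    instance
      ℚ-number : Number ℚ
      ℚ-number = number

    -- With s = t₃ w = t₃ / 4t₄ the relations say that t₀ … t₄ are the coefficients of t₄ (s x + y)⁴.
    module FourthPower (t₀ t₁ t₂ t₃ t₄ w : ℚ) (w-inverse : w * (4 * t₄) ≡ 1)
      (r₂ : 8 * t₂ * t₄ ≡ 3 * t₃ * t₃) (r₁ : 16 * t₁ * t₄ * t₄ ≡ t₃ * t₃ * t₃)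
      (r₀ : 256 * t₀ * t₄ * t₄ * t₄ ≡ t₃ * t₃ * t₃ * t₃) where
      open ≡-Reasoning

      linearFactor cubicFactor : List ℚ
      linearFactor = t₃ * w ∷ 1ℚ ∷ []
      cubicFactor  = t₄ * (t₃ * w) * (t₃ * w) * (t₃ * w) ∷ 3 * t₄ * (t₃ * w) * (t₃ * w)
                   ∷ 3 * t₄ * (t₃ * w) ∷ t₄ ∷ []

      factorisation : linearFactor QF.*F cubicFactor ≡ t₀ ∷ t₁ ∷ t₂ ∷ t₃ ∷ t₄ ∷ []
      factorisation = ≡-∷⁵ coefficient₀ coefficient₁ coefficient₂ coefficient₃ (ℚ.*-identityˡ t₄)
        where
        coefficient₀ : (t₃ * w) * (t₄ * (t₃ * w) * (t₃ * w) * (t₃ * w)) + 0ℚ ≡ t₀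
        coefficient₀ = begin
          (t₃ * w) * (t₄ * (t₃ * w) * (t₃ * w) * (t₃ * w)) + 0ℚ ≡⟨ solve (t₃ ∷ t₄ ∷ w ∷ []) ℚ-ring ⟩
          w * w * w * w * t₄ * (t₃ * t₃ * t₃ * t₃)              ≡⟨ cong (w * w * w * w * t₄ *_) r₀ ⟨
          w * w * w * w * t₄ * (256 * t₀ * t₄ * t₄ * t₄)        ≡⟨ solve (t₀ ∷ t₄ ∷ w ∷ []) ℚ-ring ⟩
          w * (4 * t₄) * (w * (4 * t₄)) * (w * (4 * t₄)) * (w * (4 * t₄)) * t₀
                                                  ≡⟨ cong (λ u → u * u * u * u * t₀) w-inverse ⟩
          1 * 1 * 1 * 1 * t₀                      ≡⟨ ℚ.*-identityˡ t₀ ⟩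
          t₀                                      ∎
        coefficient₁ : (t₃ * w) * (3 * t₄ * (t₃ * w) * (t₃ * w))
                       + (1ℚ * (t₄ * (t₃ * w) * (t₃ * w) * (t₃ * w)) + 0ℚ) ≡ t₁
        coefficient₁ = begin
          (t₃ * w) * (3 * t₄ * (t₃ * w) * (t₃ * w)) + (1ℚ * (t₄ * (t₃ * w) * (t₃ * w) * (t₃ * w)) + 0ℚ)
                                                  ≡⟨ solve (t₃ ∷ t₄ ∷ w ∷ []) ℚ-ring ⟩
          4 * w * w * w * t₄ * (t₃ * t₃ * t₃)     ≡⟨ cong (4 * w * w * w * t₄ *_) r₁ ⟨
          4 * w * w * w * t₄ * (16 * t₁ * t₄ * t₄) ≡⟨ solve (t₁ ∷ t₄ ∷ w ∷ []) ℚ-ring ⟩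
          w * (4 * t₄) * (w * (4 * t₄)) * (w * (4 * t₄)) * t₁
                                                  ≡⟨ cong (λ u → u * u * u * t₁) w-inverse ⟩
          1 * 1 * 1 * t₁                          ≡⟨ ℚ.*-identityˡ t₁ ⟩
          t₁                                      ∎
        coefficient₂ : (t₃ * w) * (3 * t₄ * (t₃ * w)) + 1ℚ * (3 * t₄ * (t₃ * w) * (t₃ * w)) ≡ t₂
        coefficient₂ = begin
          (t₃ * w) * (3 * t₄ * (t₃ * w)) + 1ℚ * (3 * t₄ * (t₃ * w) * (t₃ * w))
                                                  ≡⟨ solve (t₃ ∷ t₄ ∷ w ∷ []) ℚ-ring ⟩
          2 * w * w * t₄ * (3 * t₃ * t₃)          ≡⟨ cong (2 * w * w * t₄ *_) r₂ ⟨
          2 * w * w * t₄ * (8 * t₂ * t₄)          ≡⟨ solve (t₂ ∷ t₄ ∷ w ∷ []) ℚ-ring ⟩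
          w * (4 * t₄) * (w * (4 * t₄)) * t₂      ≡⟨ cong (λ u → u * u * t₂) w-inverse ⟩
          1 * 1 * t₂                              ≡⟨ ℚ.*-identityˡ t₂ ⟩
          t₂                                      ∎
        coefficient₃ : (t₃ * w) * t₄ + 1ℚ * (3 * t₄ * (t₃ * w)) ≡ t₃
        coefficient₃ = begin
          (t₃ * w) * t₄ + 1ℚ * (3 * t₄ * (t₃ * w)) ≡⟨ solve (t₃ ∷ t₄ ∷ w ∷ []) ℚ-ring ⟩
          w * (4 * t₄) * t₃                        ≡⟨ cong (_* t₃) w-inverse ⟩
          1 * t₃                                   ≡⟨ ℚ.*-identityˡ t₃ ⟩
          t₃                                       ∎

  a₄≡0⇒reducible : ∀ a₀ a₁ a₂ a₃ {a₄} → a₄ ≡ 0ℤ → ReducibleQ (quartic a₀ a₁ a₂ a₃ a₄)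
  a₄≡0⇒reducible a₀ a₁ a₂ a₃ refl =
    1ℚ ∷ 0ℚ ∷ [] , toℚ a₀ ∷ toℚ a₁ ∷ toℚ a₂ ∷ toℚ a₃ ∷ [] , s≤s (s≤s z≤n) , s≤s (s≤s z≤n) ,
    x*cubic (toℚ a₀) (toℚ a₁) (toℚ a₂) (toℚ a₃)

  fourthPower⇒reducible : ∀ a₀ a₁ a₂ a₃ a₄ → a₄ ≢ 0ℤ →
    + 8 ℤ.* a₂ ℤ.* a₄ ≡ + 3 ℤ.* a₃ ℤ.* a₃ →
    + 16 ℤ.* a₁ ℤ.* a₄ ℤ.* a₄ ≡ a₃ ℤ.* a₃ ℤ.* a₃ →
    + 256 ℤ.* a₀ ℤ.* a₄ ℤ.* a₄ ℤ.* a₄ ≡ a₃ ℤ.* a₃ ℤ.* a₃ ℤ.* a₃ →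
    ReducibleQ (quartic a₀ a₁ a₂ a₃ a₄)
  fourthPower⇒reducible a₀ a₁ a₂ a₃ a₄ a₄≢0 R₂ R₁ R₀ =
    linearFactor , cubicFactor , s≤s (s≤s z≤n) , s≤s (s≤s z≤n) , factorisation
    where
    -- Naming the casts keeps the elaborator from unfolding ℚ arithmetic on toℚ aᵢ.
    t₀ t₁ t₂ t₃ t₄ : ℚ
    t₀ = toℚ a₀
    t₁ = toℚ a₁
    t₂ = toℚ a₂
    t₃ = toℚ a₃
    t₄ = toℚ a₄
    4t₄≢0 : toℚ (+ 4) * t₄ ≢ 0ℚ
    4t₄≢0 4t₄≡0 = a₄≢0 (ℤ.*-cancelˡ-≡ (+ 4) a₄ 0ℤ (toℚ-injective (trans (toℚ-* (+ 4) a₄) 4t₄≡0)))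
    instance
      4t₄-nonZero : NonZero (toℚ (+ 4) * t₄)
      4t₄-nonZero = ≢-nonZero 4t₄≢0
    open FourthPower t₀ t₁ t₂ t₃ t₄ (1/ (toℚ (+ 4) * t₄)) (ℚ.*-inverseˡ (toℚ (+ 4) * t₄))
      (toℚ-transport (toℚ-foldl-* (+ 8) (a₂ ∷ a₄ ∷ [])) (toℚ-foldl-* (+ 3) (a₃ ∷ a₃ ∷ [])) R₂)
      (toℚ-transport (toℚ-foldl-* (+ 16) (a₁ ∷ a₄ ∷ a₄ ∷ [])) (toℚ-foldl-* a₃ (a₃ ∷ a₃ ∷ [])) R₁)
      (toℚ-transport (toℚ-foldl-* (+ 256) (a₀ ∷ a₄ ∷ a₄ ∷ a₄ ∷ []))
                     (toℚ-foldl-* a₃ (a₃ ∷ a₃ ∷ a₃ ∷ [])) R₀)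

open import Data.Integer using (_*_; _+_; _-_; -_; _≟_)
open import Tactic.RingSolver.Core.Expression using (Expr; Κ; _⊕_; _⊗_; ⊝_)
open import Tactic.RingSolver.NonReflective ℤ-Solver.ring using (solve; _⊜_)

fromCoeffs : List ℤ → Quartic
fromCoeffs (g₀ ∷ g₁ ∷ g₂ ∷ g₃ ∷ g₄ ∷ _) = quartic g₀ g₁ g₂ g₃ g₄
fromCoeffs _                           = quartic 0ℤ 0ℤ 0ℤ 0ℤ 0ℤ

transform : Quartic → ℤ → ℤ → ℤ → ℤ → Quartic
transform F b c d e = fromCoeffs (substCoeffs F b c d e)

transform-equivalent : ∀ F b c d e →
  b * e - c * d ≡ + 1 ⊎ b * e - c * d ≡ - + 1 → Equivalent F (transform F b c d e)
transform-equivalent F b c d e unimodular = b , c , d , e , unimodular , refl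

shear lowerShear : ℤ → Quartic → Quartic
shear      k F = transform F (+ 1) k 0ℤ (+ 1)
lowerShear l F = transform F (+ 1) 0ℤ l (+ 1)

hessA₀ hessA₁ hessA₂ : Quartic → ℤ
hessA₀ (quartic g₀ g₁ g₂ g₃ g₄) = + 3 * (+ 8 * g₀ * g₂ - + 3 * g₁ * g₁)
hessA₁ (quartic g₀ g₁ g₂ g₃ g₄) = + 12 * (+ 6 * g₀ * g₃ - g₁ * g₂)
hessA₂ (quartic g₀ g₁ g₂ g₃ g₄) = + 144 * g₀ * g₄ + + 18 * g₁ * g₃ - + 12 * g₂ * g₂

hessian : Quartic → Quartic
hessian F = quartic (hessA₀ F) (hessA₁ F) (hessA₂ F) (hessA₃ F) (hessA₄ F)

valueAt : Quartic → ℤ → ℤ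
valueAt (quartic a₀ a₁ a₂ a₃ a₄) k =
  a₀ * (k * k * k * k) + a₁ * (k * k * k) + a₂ * (k * k) + a₃ * k + a₄

quartic-ext : ∀ {F G} →
  a₀ F ≡ a₀ G → a₁ F ≡ a₁ G → a₂ F ≡ a₂ G → a₃ F ≡ a₃ G → a₄ F ≡ a₄ G → F ≡ G
quartic-ext refl refl refl refl refl = refl

-- Copies of the definitions above over ring expressions. Evaluating them gives back the
-- definitions over ℤ on the nose, so that solve n (λ … → lhs ⊜ rhs) refl proves identities
-- stated with substCoeffs and the Hessian coefficients.
module Symbolic {n : ℕ} where
  open FormOps {Expr ℤ n} (Κ 0ℤ) (Κ (+ 1)) _⊕_ _⊗_

  Form : Set
  Form = List (Expr ℤ n)

  infixl 6 _⊖_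
  _⊖_ : Expr ℤ n → Expr ℤ n → Expr ℤ n
  x ⊖ y = x ⊕ ⊝ y

  transformˢ : Form → (b c d e : Expr ℤ n) → Form
  transformˢ (a₀ ∷ a₁ ∷ a₂ ∷ a₃ ∷ a₄ ∷ _) b c d e =
    term a₀ 4 0 +F (term a₁ 3 1 +F (term a₂ 2 2 +F (term a₃ 1 3 +F term a₄ 0 4)))
    where
    term : Expr ℤ n → ℕ → ℕ → Form
    term a i j = (a ∷ []) *F (((b ∷ c ∷ []) ^F i) *F ((d ∷ e ∷ []) ^F j))
  transformˢ _ b c d e = transformˢ (Κ 0ℤ ∷ Κ 0ℤ ∷ Κ 0ℤ ∷ Κ 0ℤ ∷ Κ 0ℤ ∷ []) b c d e

  coeffˢ : ℕ → Form → Expr ℤ n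
  coeffˢ _       []      = Κ 0ℤ
  coeffˢ zero    (g ∷ _) = g
  coeffˢ (suc i) (_ ∷ G) = coeffˢ i G

  hessA₀ˢ hessA₁ˢ hessA₂ˢ hessA₃ˢ hessA₄ˢ : Form → Expr ℤ n
  hessA₀ˢ G = Κ (+ 3) ⊗ (Κ (+ 8) ⊗ coeffˢ 0 G ⊗ coeffˢ 2 G ⊖ Κ (+ 3) ⊗ coeffˢ 1 G ⊗ coeffˢ 1 G)
  hessA₁ˢ G = Κ (+ 12) ⊗ (Κ (+ 6) ⊗ coeffˢ 0 G ⊗ coeffˢ 3 G ⊖ coeffˢ 1 G ⊗ coeffˢ 2 G)
  hessA₂ˢ G = Κ (+ 144) ⊗ coeffˢ 0 G ⊗ coeffˢ 4 G ⊕ Κ (+ 18) ⊗ coeffˢ 1 G ⊗ coeffˢ 3 G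
              ⊖ Κ (+ 12) ⊗ coeffˢ 2 G ⊗ coeffˢ 2 G
  hessA₃ˢ G = Κ (+ 12) ⊗ (Κ (+ 6) ⊗ coeffˢ 1 G ⊗ coeffˢ 4 G ⊖ coeffˢ 2 G ⊗ coeffˢ 3 G)
  hessA₄ˢ G = Κ (+ 3) ⊗ (Κ (+ 8) ⊗ coeffˢ 2 G ⊗ coeffˢ 4 G ⊖ Κ (+ 3) ⊗ coeffˢ 3 G ⊗ coeffˢ 3 G)

  hessianˢ : Form → Form
  hessianˢ G = hessA₀ˢ G ∷ hessA₁ˢ G ∷ hessA₂ˢ G ∷ hessA₃ˢ G ∷ hessA₄ˢ G ∷ []

  valueAtˢ : Form → Expr ℤ n → Expr ℤ n
  valueAtˢ G k = coeffˢ 0 G ⊗ (k ⊗ k ⊗ k ⊗ k) ⊕ coeffˢ 1 G ⊗ (k ⊗ k ⊗ k) ⊕ coeffˢ 2 G ⊗ (k ⊗ k)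
                 ⊕ coeffˢ 3 G ⊗ k ⊕ coeffˢ 4 G

open Symbolic

-- The Hessian is covariant under unimodular substitutions, so the y⁴-coefficient of the
-- Hessian of F(x + ky, y) is H(k, 1), and the Hessian of G(x, lx + y) is H(x, lx + y).
hessA₄-shear : ∀ k F → hessA₄ (shear k F) ≡ valueAt (hessian F) k
hessA₄-shear k (quartic a₀ a₁ a₂ a₃ a₄) = solve 6 (λ a₀ a₁ a₂ a₃ a₄ k →
  let F = a₀ ∷ a₁ ∷ a₂ ∷ a₃ ∷ a₄ ∷ [] in
  hessA₄ˢ (transformˢ F (Κ (+ 1)) k (Κ 0ℤ) (Κ (+ 1))) ⊜ valueAtˢ (hessianˢ F) k)
  refl a₀ a₁ a₂ a₃ a₄ k

hessA₄-lowerShear : ∀ l G → hessA₄ (lowerShear l G) ≡ hessA₄ G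
hessA₄-lowerShear l (quartic g₀ g₁ g₂ g₃ g₄) = solve 6 (λ g₀ g₁ g₂ g₃ g₄ l →
  let G = g₀ ∷ g₁ ∷ g₂ ∷ g₃ ∷ g₄ ∷ [] in
  hessA₄ˢ (transformˢ G (Κ (+ 1)) (Κ 0ℤ) l (Κ (+ 1))) ⊜ hessA₄ˢ G)
  refl g₀ g₁ g₂ g₃ g₄ l

hessA₃-lowerShear : ∀ l G → hessA₃ (lowerShear l G) ≡ hessA₃ G + + 4 * l * hessA₄ G
hessA₃-lowerShear l (quartic g₀ g₁ g₂ g₃ g₄) = solve 6 (λ g₀ g₁ g₂ g₃ g₄ l →
  let G = g₀ ∷ g₁ ∷ g₂ ∷ g₃ ∷ g₄ ∷ [] in
  hessA₃ˢ (transformˢ G (Κ (+ 1)) (Κ 0ℤ) l (Κ (+ 1))) ⊜ (hessA₃ˢ G ⊕ Κ (+ 4) ⊗ l ⊗ hessA₄ˢ G))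
  refl g₀ g₁ g₂ g₃ g₄ l

lowerShear∘shear : ∀ l k F → lowerShear l (shear k F) ≡ transform F (+ 1 + k * l) k l (+ 1)
lowerShear∘shear l k (quartic a₀ a₁ a₂ a₃ a₄) = quartic-ext
  (solve 7 (coefficient 0) refl a₀ a₁ a₂ a₃ a₄ k l) (solve 7 (coefficient 1) refl a₀ a₁ a₂ a₃ a₄ k l)
  (solve 7 (coefficient 2) refl a₀ a₁ a₂ a₃ a₄ k l) (solve 7 (coefficient 3) refl a₀ a₁ a₂ a₃ a₄ k l)
  (solve 7 (coefficient 4) refl a₀ a₁ a₂ a₃ a₄ k l)
  where
  coefficient : ℕ → (a₀ a₁ a₂ a₃ a₄ k l : Expr ℤ 7) → Expr ℤ 7 × Expr ℤ 7
  coefficient i a₀ a₁ a₂ a₃ a₄ k l =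
    let F = a₀ ∷ a₁ ∷ a₂ ∷ a₃ ∷ a₄ ∷ [] in
    coeffˢ i (transformˢ (transformˢ F (Κ (+ 1)) k (Κ 0ℤ) (Κ (+ 1))) (Κ (+ 1)) (Κ 0ℤ) l (Κ (+ 1)))
    ⊜ coeffˢ i (transformˢ F (Κ (+ 1) ⊕ k ⊗ l) k l (Κ (+ 1)))

shear-equivalent : ∀ k F → Equivalent F (shear k F)
shear-equivalent k F = transform-equivalent F (+ 1) k 0ℤ (+ 1) (inj₁ (ℤ-Solver.solve (k ∷ [])))

lowerShear∘shear-equivalent : ∀ l k F → Equivalent F (lowerShear l (shear k F))
lowerShear∘shear-equivalent l k F = subst (Equivalent F) (sym (lowerShear∘shear l k F))
  (transform-equivalent F (+ 1 + k * l) k l (+ 1) (inj₁ (ℤ-Solver.solve (k ∷ l ∷ []))))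

*-≢0 : ∀ i j → i ≢ 0ℤ → j ≢ 0ℤ → i * j ≢ 0ℤ
*-≢0 i j i≢0 j≢0 i*j≡0 = [ i≢0 , j≢0 ]′ (ℤ.i*j≡0⇒i≡0∨j≡0 i i*j≡0)

EquivalentWithA₃A₄≢0 : Quartic → Set
EquivalentWithA₃A₄≢0 F = Σ Quartic λ G → Equivalent F G × (hessA₃ G * hessA₄ G ≢ 0ℤ)

hessian≢0⇒equivalentWithA₃A₄≢0 : ∀ F k → valueAt (hessian F) k ≢ 0ℤ → EquivalentWithA₃A₄≢0 F
hessian≢0⇒equivalentWithA₃A₄≢0 F k H≢0 = byCases (hessA₃ G ≟ 0ℤ)
  where
  G : Quartic
  G = shear k F
  A₄≢0 : hessA₄ G ≢ 0ℤ
  A₄≢0 A₄≡0 = H≢0 (trans (sym (hessA₄-shear k F)) A₄≡0)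
  A₃′A₄′≡4A₄A₄ : hessA₃ G ≡ 0ℤ →
    hessA₃ (lowerShear (+ 1) G) * hessA₄ (lowerShear (+ 1) G) ≡ + 4 * hessA₄ G * hessA₄ G
  A₃′A₄′≡4A₄A₄ A₃≡0 = begin
    hessA₃ (lowerShear (+ 1) G) * hessA₄ (lowerShear (+ 1) G)
      ≡⟨ cong₂ _*_ (hessA₃-lowerShear (+ 1) G) (hessA₄-lowerShear (+ 1) G) ⟩
    (hessA₃ G + + 4 * hessA₄ G) * hessA₄ G ≡⟨ cong (λ a → (a + + 4 * hessA₄ G) * hessA₄ G) A₃≡0 ⟩
    (0ℤ + + 4 * hessA₄ G) * hessA₄ G       ≡⟨ cong (_* hessA₄ G) (ℤ.+-identityˡ (+ 4 * hessA₄ G)) ⟩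
    + 4 * hessA₄ G * hessA₄ G              ∎
    where open ≡-Reasoning
  byCases : Dec (hessA₃ G ≡ 0ℤ) → EquivalentWithA₃A₄≢0 F
  byCases (no A₃≢0)  = G , shear-equivalent k F , *-≢0 (hessA₃ G) (hessA₄ G) A₃≢0 A₄≢0
  byCases (yes A₃≡0) = lowerShear (+ 1) G , lowerShear∘shear-equivalent (+ 1) k F ,
    subst (_≢ 0ℤ) (sym (A₃′A₄′≡4A₄A₄ A₃≡0)) (*-≢0 (+ 4 * hessA₄ G) (hessA₄ G) (*-≢0 (+ 4) (hessA₄ G) (λ ()) A₄≢0) A₄≢0)

nodes : List ℤ
nodes = 0ℤ ∷ + 1 ∷ - + 1 ∷ + 2 ∷ - + 2 ∷ []

vanishesOnNodes⇒≡0 : ∀ P → All (λ k → valueAt P k ≡ 0ℤ) nodes → P ≡ quartic 0ℤ 0ℤ 0ℤ 0ℤ 0ℤ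
vanishesOnNodes⇒≡0 P@(quartic p₀ p₁ p₂ p₃ p₄)
                   (v₀ All.∷ v₁ All.∷ v₋₁ All.∷ v₂ All.∷ v₋₂ All.∷ All.[]) = quartic-ext
  (ℤ.*-cancelˡ-≡ (+ 24) p₀ 0ℤ 24p₀≡0) (ℤ.*-cancelˡ-≡ (+ 12) p₁ 0ℤ 12p₁≡0)
  (ℤ.*-cancelˡ-≡ (+ 24) p₂ 0ℤ 24p₂≡0) (ℤ.*-cancelˡ-≡ (+ 12) p₃ 0ℤ 12p₃≡0) (trans p₄≡V v₀)
  where
  V : ∀ {n} → (p₀ p₁ p₂ p₃ p₄ : Expr ℤ n) → ℤ → Expr ℤ n
  V p₀ p₁ p₂ p₃ p₄ k = valueAtˢ (p₀ ∷ p₁ ∷ p₂ ∷ p₃ ∷ p₄ ∷ []) (Κ k)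

  24p₀≡V : + 24 * p₀ ≡ valueAt P (+ 2) + valueAt P (- + 2)
                      - + 4 * (valueAt P (+ 1) + valueAt P (- + 1)) + + 6 * valueAt P 0ℤ
  24p₀≡V = solve 5 (λ p₀ p₁ p₂ p₃ p₄ → let V = V p₀ p₁ p₂ p₃ p₄ in
    Κ (+ 24) ⊗ p₀ ⊜ (V (+ 2) ⊕ V (- + 2) ⊖ Κ (+ 4) ⊗ (V (+ 1) ⊕ V (- + 1)) ⊕ Κ (+ 6) ⊗ V 0ℤ))
    refl p₀ p₁ p₂ p₃ p₄
  12p₁≡V : + 12 * p₁ ≡ valueAt P (+ 2) - valueAt P (- + 2) - + 2 * (valueAt P (+ 1) - valueAt P (- + 1))
  12p₁≡V = solve 5 (λ p₀ p₁ p₂ p₃ p₄ → let V = V p₀ p₁ p₂ p₃ p₄ in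
    Κ (+ 12) ⊗ p₁ ⊜ (V (+ 2) ⊖ V (- + 2) ⊖ Κ (+ 2) ⊗ (V (+ 1) ⊖ V (- + 1))))
    refl p₀ p₁ p₂ p₃ p₄
  24p₂≡V : + 24 * p₂ ≡ + 16 * (valueAt P (+ 1) + valueAt P (- + 1))
                      - (valueAt P (+ 2) + valueAt P (- + 2)) - + 30 * valueAt P 0ℤ
  24p₂≡V = solve 5 (λ p₀ p₁ p₂ p₃ p₄ → let V = V p₀ p₁ p₂ p₃ p₄ in
    Κ (+ 24) ⊗ p₂ ⊜ (Κ (+ 16) ⊗ (V (+ 1) ⊕ V (- + 1)) ⊖ (V (+ 2) ⊕ V (- + 2)) ⊖ Κ (+ 30) ⊗ V 0ℤ))
    refl p₀ p₁ p₂ p₃ p₄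
  12p₃≡V : + 12 * p₃ ≡ + 8 * (valueAt P (+ 1) - valueAt P (- + 1)) - (valueAt P (+ 2) - valueAt P (- + 2))
  12p₃≡V = solve 5 (λ p₀ p₁ p₂ p₃ p₄ → let V = V p₀ p₁ p₂ p₃ p₄ in
    Κ (+ 12) ⊗ p₃ ⊜ (Κ (+ 8) ⊗ (V (+ 1) ⊖ V (- + 1)) ⊖ (V (+ 2) ⊖ V (- + 2))))
    refl p₀ p₁ p₂ p₃ p₄
  p₄≡V : p₄ ≡ valueAt P 0ℤ
  p₄≡V = solve 5 (λ p₀ p₁ p₂ p₃ p₄ → p₄ ⊜ V p₀ p₁ p₂ p₃ p₄ 0ℤ) refl p₀ p₁ p₂ p₃ p₄

  24p₀≡0 : + 24 * p₀ ≡ + 24 * 0ℤ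
  24p₀≡0 rewrite 24p₀≡V | v₀ | v₁ | v₋₁ | v₂ | v₋₂ = refl
  12p₁≡0 : + 12 * p₁ ≡ + 12 * 0ℤ
  12p₁≡0 rewrite 12p₁≡V | v₁ | v₋₁ | v₂ | v₋₂ = refl
  24p₂≡0 : + 24 * p₂ ≡ + 24 * 0ℤ
  24p₂≡0 rewrite 24p₂≡V | v₀ | v₁ | v₋₁ | v₂ | v₋₂ = refl
  12p₃≡0 : + 12 * p₃ ≡ + 12 * 0ℤ
  12p₃≡0 rewrite 12p₃≡V | v₁ | v₋₁ | v₂ | v₋₂ = refl

module _ (a₀ a₁ a₂ a₃ a₄ : ℤ) where
  private
    F = quartic a₀ a₁ a₂ a₃ a₄

  9R₁≡A₃A₄ : + 9 * (+ 16 * a₁ * a₄ * a₄ - a₃ * a₃ * a₃) ≡ hessA₃ F * (+ 2 * a₄) + hessA₄ F * a₃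
  9R₁≡A₃A₄ = solve 5 (λ a₀ a₁ a₂ a₃ a₄ → let F = a₀ ∷ a₁ ∷ a₂ ∷ a₃ ∷ a₄ ∷ [] in
    Κ (+ 9) ⊗ (Κ (+ 16) ⊗ a₁ ⊗ a₄ ⊗ a₄ ⊖ a₃ ⊗ a₃ ⊗ a₃)
    ⊜ (hessA₃ˢ F ⊗ (Κ (+ 2) ⊗ a₄) ⊕ hessA₄ˢ F ⊗ a₃))
    refl a₀ a₁ a₂ a₃ a₄

  9R₀≡A₂A₃A₄ : + 9 * (+ 256 * a₀ * a₄ * a₄ * a₄ - a₃ * a₃ * a₃ * a₃)
    ≡ hessA₂ F * (+ 16 * a₄ * a₄) - hessA₃ F * (+ 4 * a₃ * a₄) + hessA₄ F * (+ 8 * a₂ * a₄ + a₃ * a₃)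
  9R₀≡A₂A₃A₄ = solve 5 (λ a₀ a₁ a₂ a₃ a₄ → let F = a₀ ∷ a₁ ∷ a₂ ∷ a₃ ∷ a₄ ∷ [] in
    Κ (+ 9) ⊗ (Κ (+ 256) ⊗ a₀ ⊗ a₄ ⊗ a₄ ⊗ a₄ ⊖ a₃ ⊗ a₃ ⊗ a₃ ⊗ a₃)
    ⊜ (hessA₂ˢ F ⊗ (Κ (+ 16) ⊗ a₄ ⊗ a₄) ⊖ hessA₃ˢ F ⊗ (Κ (+ 4) ⊗ a₃ ⊗ a₄)
       ⊕ hessA₄ˢ F ⊗ (Κ (+ 8) ⊗ a₂ ⊗ a₄ ⊕ a₃ ⊗ a₃)))
    refl a₀ a₁ a₂ a₃ a₄

  hessian-degenerate⇒reducible : hessA₂ F ≡ 0ℤ → hessA₃ F ≡ 0ℤ → hessA₄ F ≡ 0ℤ → ReducibleQ F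
  hessian-degenerate⇒reducible A₂≡0 A₃≡0 A₄≡0 = byCases (a₄ ≟ 0ℤ)
    where
    R₂ : + 8 * a₂ * a₄ ≡ + 3 * a₃ * a₃
    R₂ = ℤ.i-j≡0⇒i≡j _ _ (ℤ.*-cancelˡ-≡ (+ 3) (+ 8 * a₂ * a₄ - + 3 * a₃ * a₃) 0ℤ A₄≡0)
    R₁ : + 16 * a₁ * a₄ * a₄ ≡ a₃ * a₃ * a₃
    R₁ = ℤ.i-j≡0⇒i≡j _ _ (ℤ.*-cancelˡ-≡ (+ 9) (+ 16 * a₁ * a₄ * a₄ - a₃ * a₃ * a₃) 0ℤ
      (trans 9R₁≡A₃A₄ (cong₂ (λ A₃ A₄ → A₃ * (+ 2 * a₄) + A₄ * a₃) A₃≡0 A₄≡0)))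
    R₀ : + 256 * a₀ * a₄ * a₄ * a₄ ≡ a₃ * a₃ * a₃ * a₃
    R₀ = ℤ.i-j≡0⇒i≡j _ _ (ℤ.*-cancelˡ-≡ (+ 9) (+ 256 * a₀ * a₄ * a₄ * a₄ - a₃ * a₃ * a₃ * a₃) 0ℤ
      (trans 9R₀≡A₂A₃A₄ (trans
        (cong₂ (λ A₂ A₃ → A₂ * (+ 16 * a₄ * a₄) - A₃ * (+ 4 * a₃ * a₄) + hessA₄ F * (+ 8 * a₂ * a₄ + a₃ * a₃))
               A₂≡0 A₃≡0)
        (cong (λ A₄ → 0ℤ - 0ℤ + A₄ * (+ 8 * a₂ * a₄ + a₃ * a₃)) A₄≡0))))
    byCases : Dec (a₄ ≡ 0ℤ) → ReducibleQ F
    byCases (yes a₄≡0) = a₄≡0⇒reducible a₀ a₁ a₂ a₃ a₄≡0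
    byCases (no a₄≢0)  = fourthPower⇒reducible a₀ a₁ a₂ a₃ a₄ a₄≢0 R₂ R₁ R₀

lemma3p1 : (F : Quartic) → IrreducibleQ F → J F ≡ + 0 →
    Σ Quartic λ G → Equivalent F G × (hessA₃ G * hessA₄ G ≢ + 0)
lemma3p1 F@(quartic f₀ f₁ f₂ f₃ f₄) irreducible _ =
  byCases (all? (λ k → valueAt (hessian F) k ≟ 0ℤ) nodes)
  where
  byCases : Dec (All (λ k → valueAt (hessian F) k ≡ 0ℤ) nodes) → EquivalentWithA₃A₄≢0 F
  byCases (no ¬vanishes) = uncurry (hessian≢0⇒equivalentWithA₃A₄≢0 F)
    (satisfied (¬All⇒Any¬ (λ k → valueAt (hessian F) k ≟ 0ℤ) nodes ¬vanishes))
  byCases (yes vanishes) = ⊥-elim (irreducible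
    (hessian-degenerate⇒reducible f₀ f₁ f₂ f₃ f₄ (cong a₂ H≡0) (cong a₃ H≡0) (cong a₄ H≡0)))
    where
    H≡0 : hessian F ≡ quartic 0ℤ 0ℤ 0ℤ 0ℤ 0ℤ
    H≡0 = vanishesOnNodes⇒≡0 (hessian F) vanishes
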